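{- Let $T$ be a finite tree with at least two vertices, $D$ a distribution on $T$, $\omega$ a nonnegative integer function on $V(T)$, and $C=D-\omega$. Let $v$ be a leaf of $T$ with neighbor $u$, and define $C'$ on $V(T)\setminus\{v\}$ by $C'(x)=C(x)$ for $x\neq u$ and $C'(u)=C(u)+\lfloor C(v)/2\rfloor$ if $C(v)\ge 0$, $C'(u)=C(u)+2C(v)$ if $C(v)<0$. Then $C$ is $0$-solvable in $T$ if and only if $C'$ is $0$-solvable in $T\setminus v$.
   Context: A distribution assigns nonnegative integers (pebbles) to vertices; a generalized distribution assigns arbitrary integers. A pebbling move on a generalized distribution $C$ removes two pebbles from a vertex $x$ with $C(x)\ge2$ and adds one pebble to an adjacent vertex. $C$ is $0$-solvable in a graph if a sequence of pebbling moves in that graph reaches $C^*$ with $C^*\ge 0$ everywhere. -}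

module Defs where

open import Data.Nat using (ℕ; zero; suc; _≤_; _/_)
open import Data.Integer as ℤ using (ℤ; +_; -[1+_]; _-_; _+_; _*_)
open import Data.Fin using (Fin; punchIn)
open import Data.List using (List; []; _∷_; _++_; [_]; length)
open import Data.List.Relation.Unary.Linked using (Linked)
open import Data.List.Relation.Unary.Unique.Propositional using (Unique)
open import Data.Product using (Σ; ∃; _×_)
open import Relation.Binary using (Rel)
open import Relation.Binary.Construct.Closure.ReflexiveTransitive using (Star)
open import Relation.Binary.PropositionalEquality using (_≡_; _≢_)
open import Relation.Nullary using (¬_; Dec; yes; no)
open import Data.Fin using (_≟_)
open import Level using (0ℓ)

Graph : ℕ → Set₁
Graph n = Rel (Fin n) 0ℓ

IsSimple : ∀ {n} → Graph n → Set
IsSimple {n} G = (∀ (x y : Fin n) → G x y → G y x) × (∀ (x : Fin n) → ¬ G x x)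

Connected : ∀ {n} → Graph n → Set
Connected {n} G = ∀ (x y : Fin n) → Star G x y

-- A cycle x ∷ xs : at least 3 distinct vertices, consecutive ones adjacent,
-- and the last adjacent to the first.
IsCycle : ∀ {n} → Graph n → Fin n → List (Fin n) → Set
IsCycle G x xs = (2 ≤ length xs) × Unique (x ∷ xs) × Linked G ((x ∷ xs) ++ [ x ])

Acyclic : ∀ {n} → Graph n → Set
Acyclic {n} G = ∀ (x : Fin n) (xs : List (Fin n)) → ¬ IsCycle G x xs

IsTree : ∀ {n} → Graph n → Set
IsTree G = IsSimple G × Connected G × Acyclic G

IsLeafWithNeighbour : ∀ {n} → Graph n → Fin n → Fin n → Set
IsLeafWithNeighbour {n} G v u = G v u × (∀ (w : Fin n) → G v w → w ≡ u)

-- The graph T \ v, with vertex set Fin n identified with Fin (suc n) ∖ {v} via punchIn v.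
deleteVertex : ∀ {n} → Graph (suc n) → Fin (suc n) → Graph n
deleteVertex G v i j = G (punchIn v i) (punchIn v j)

Distribution : ℕ → Set
Distribution n = Fin n → ℕ

GenDistribution : ℕ → Set
GenDistribution n = Fin n → ℤ

update : ∀ {n} → GenDistribution n → Fin n → (ℤ → ℤ) → GenDistribution n
update C x f y with y ≟ x
... | yes _ = f (C y)
... | no _ = C y

data Move {n} (G : Graph n) : GenDistribution n → GenDistribution n → Set where
  move : ∀ (C : GenDistribution n) (x y : Fin n) → G x y → + 2 ℤ.≤ C x →
         Move G C (update (update C x (λ z → z - + 2)) y (λ z → z + + 1))

Reachable : ∀ {n} → Graph n → GenDistribution n → GenDistribution n → Set
Reachable G = Star (Move G)

ZeroSolvable : ∀ {n} → Graph n → GenDistribution n → Set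
ZeroSolvable {n} G C = Σ (GenDistribution n) λ C* → Reachable G C C* × (∀ (x : Fin n) → + 0 ℤ.≤ C* x)

_minus_ : ∀ {n} → Distribution n → (Fin n → ℕ) → GenDistribution n
(D minus ω) x = + D x - + ω x

transfer : ℤ → ℤ
transfer (+ k) = + (k / 2)
transfer -[1+ k ] = + 2 * -[1+ k ]

collapse : ∀ {n} → GenDistribution (suc n) → Fin (suc n) → Fin (suc n) → GenDistribution n
collapse C v u x with punchIn v x ≟ u
... | yes _ = C (punchIn v x) + transfer (C v)
... | no _ = C (punchIn v x)

module Submission where

-- The proof avoids reasoning about the order of pebbling moves.  For an
-- arbitrary graph G, a list m of edges has a net effect net m (each edge
-- x → y contributes 𝟙 y − 2·𝟙 x), and we show
--
--   C is 0-solvable in G  ⇔  C + net m ≥ 0 for some list m of edges.    (*)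
--
-- "⇒" records the moves.  "⇐" executes the edges of m one by one; when no
-- edge of m can fire, a closed walk can be deleted from m without
-- decreasing its net effect (a no-cycle argument), so the list shrinks.
--
-- For the leaf v, an edge list of T splits into a list m' of edges of T ∖ v,
-- a edges u → v and b edges v → u.  By (*), C is solvable in T iff
-- C(v) + a − 2b ≥ 0 and C + net m' + 𝟙_u (b − 2a) ≥ 0 on T ∖ v for some such
-- split.  Arithmetic on ⌊C(v)/2⌋ shows that the largest possible b − 2a
-- is exactly the amount `transfer (C v)` given to u in C', and (*) for
-- T ∖ v finishes the proof.

open import Defs
open import Data.Nat as ℕ using (ℕ; zero; suc; s≤s)
import Data.Nat.Properties as ℕP
open import Data.Nat.DivMod using (m≡m%n+[m/n]*n; m%n<n)
open import Data.Integer as ℤ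
  using (ℤ; +_; -[1+_]; _+_; _-_; _*_; -_; _≤_; _≤?_; +≤+)
import Data.Integer.Properties as ℤP
open import Data.Integer.Tactic.RingSolver using (solve-∀)
open import Data.Fin using (Fin; punchIn; punchOut; _≟_)
import Data.Fin.Properties as FinP
open import Data.List using (List; []; _∷_; [_]; _++_; length)
open import Data.List.Properties using (length-removeAt′)
open import Data.List.Relation.Unary.Any as Any using (Any; any?; _─_)
open import Data.List.Relation.Unary.Any.Properties using (lookup-result)
open import Data.List.Relation.Unary.All as All using (All; lookupAny)
open import Data.List.Relation.Unary.All.Properties using (¬Any⇒All¬; ─⁺)
open import Data.Product using (Σ; _×_; _,_; proj₁; proj₂)
open import Data.Empty using (⊥-elim)
open import Function.Bundles using (_⇔_; mk⇔; Equivalence)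
open import Function.Related.Propositional using (module EquationalReasoning)
open import Function.Construct.Symmetry using (⇔-sym)
open import Relation.Nullary using (¬_; yes; no; contradiction)
open import Relation.Binary.PropositionalEquality
  using (_≡_; _≢_; refl; sym; trans; cong; cong₂; subst; subst₂; module ≡-Reasoning)
open import Relation.Binary.Construct.Closure.ReflexiveTransitive using (ε; _◅_)

≤-by-slack : ∀ {x y} d → + 0 ≤ d → y ≡ x + d → x ≤ y
≤-by-slack {x} d 0≤d refl = begin
  x          ≡⟨ sym (ℤP.+-identityʳ x) ⟩
  x + + 0    ≤⟨ ℤP.+-monoʳ-≤ x 0≤d ⟩
  x + d      ∎
  where open ℤP.≤-Reasoning

-- The change at a vertex that receives `gain` pebbles and makes `loss`
-- moves (each costing two pebbles).
balance : ℤ → ℤ → ℤ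
balance gain loss = gain - (loss + loss)

balance-+ : ∀ x₁ y₁ x₂ y₂ → balance (x₁ + x₂) (y₁ + y₂) ≡ balance x₁ y₁ + balance x₂ y₂
balance-+ = lemma
  where
  lemma : ∀ x₁ y₁ x₂ y₂ → (x₁ + x₂) - ((y₁ + y₂) + (y₁ + y₂)) ≡ (x₁ - (y₁ + y₁)) + (x₂ - (y₂ + y₂))
  lemma = solve-∀

𝟙 : ∀ {n} → Fin n → Fin n → ℤ
𝟙 a z with z ≟ a
... | yes _ = + 1
... | no _ = + 0

𝟙-self : ∀ {n} (a : Fin n) → 𝟙 a a ≡ + 1
𝟙-self a with a ≟ a
... | yes _ = refl
... | no a≢a = contradiction refl a≢a

𝟙-other : ∀ {n} {a z : Fin n} → z ≢ a → 𝟙 a z ≡ + 0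
𝟙-other {a = a} {z} z≢a with z ≟ a
... | yes z≡a = contradiction z≡a z≢a
... | no _ = refl

0≤𝟙 : ∀ {n} (a z : Fin n) → + 0 ≤ 𝟙 a z
0≤𝟙 a z with z ≟ a
... | yes _ = +≤+ ℕ.z≤n
... | no _ = +≤+ ℕ.z≤n

𝟙-*-mono : ∀ {n} (a z : Fin n) {x y} → x ≤ y → 𝟙 a z * x ≤ 𝟙 a z * y
𝟙-*-mono a z = ℤP.*-monoˡ-≤-nonNeg (𝟙 a z) {{ℤ.nonNegative (0≤𝟙 a z)}}

𝟙-punchIn : ∀ {n} (v : Fin (suc n)) a b → 𝟙 (punchIn v a) (punchIn v b) ≡ 𝟙 a b
𝟙-punchIn v a b with punchIn v b ≟ punchIn v a | b ≟ a
... | yes _ | yes _ = refl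
... | no _ | no _ = refl
... | yes pb≡pa | no b≢a = contradiction (FinP.punchIn-injective v b a pb≡pa) b≢a
... | no pb≢pa | yes refl = contradiction refl pb≢pa

update-shift : ∀ {n} (C : GenDistribution n) x d z → update C x (λ w → w + d) z ≡ C z + 𝟙 x z * d
update-shift C x d z with z ≟ x
... | yes _ = cong (_+_ (C z)) (sym (ℤP.*-identityˡ d))
... | no _ = trans (sym (ℤP.+-identityʳ (C z))) (cong (_+_ (C z)) (sym (ℤP.*-zeroˡ d)))

-- The amount `transfer c` handed from a leaf holding c pebbles to its
-- neighbour is the largest value of b − 2a over all a, b ≥ 0 for which the
-- leaf stays nonnegative after receiving a pebbles and making b moves.

halve : ∀ k → + k ≡ + (k ℕ.% 2) + + (k ℕ./ 2) * + 2
halve k = begin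
  + k                                     ≡⟨ cong +_ (m≡m%n+[m/n]*n k 2) ⟩
  + (k ℕ.% 2 ℕ.+ k ℕ./ 2 ℕ.* 2)           ≡⟨ ℤP.pos-+ (k ℕ.% 2) _ ⟩
  + (k ℕ.% 2) + + (k ℕ./ 2 ℕ.* 2)         ≡⟨ cong (_+_ (+ (k ℕ.% 2))) (ℤP.pos-* (k ℕ./ 2) 2) ⟩
  + (k ℕ.% 2) + + (k ℕ./ 2) * + 2         ∎
  where open ≡-Reasoning

transfer-bound : ∀ c a b → + 0 ≤ c + balance (+ a) (+ b) → balance (+ b) (+ a) ≤ transfer c
transfer-bound (+ k) a b leaf≥0 with balance (+ b) (+ a) ≤? + (k ℕ./ 2)
... | yes bounded = bounded
... | no unbounded = contradiction (subst (+ 0 ≤_) total≡-1 total≥0) λ ()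
  where
  r = k ℕ.% 2
  q = k ℕ./ 2
  x = balance (+ b) (+ a)
  -- If b − 2a ≥ q + 1, twice this excess plus the leaf's final value plus
  -- (1 − r) + 3a is nonnegative, yet equals −1.
  excess : + 0 ≤ x - (+ 1 + + q)
  excess = ℤP.i≤j⇒0≤j-i (ℤP.i<j⇒suc[i]≤j (ℤP.≰⇒> unbounded))
  leaf≥0′ : + 0 ≤ + r + + q * + 2 + balance (+ a) (+ b)
  leaf≥0′ = subst (λ t → + 0 ≤ t + balance (+ a) (+ b)) (halve k) leaf≥0
  r≤1 : + 0 ≤ + 1 - + r
  r≤1 = ℤP.i≤j⇒0≤j-i (+≤+ (ℕP.≤-pred (m%n<n k 2)))
  total≥0 : + 0 ≤ + r + + q * + 2 + balance (+ a) (+ b) + (x - (+ 1 + + q) + (x - (+ 1 + + q)))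
                  + (+ 1 - + r) + (+ a + + a + + a)
  total≥0 = ℤP.+-mono-≤ (ℤP.+-mono-≤ (ℤP.+-mono-≤ leaf≥0′ (ℤP.+-mono-≤ excess excess)) r≤1)
              (+≤+ ℕ.z≤n)
  total≡-1 : + r + + q * + 2 + balance (+ a) (+ b) + (x - (+ 1 + + q) + (x - (+ 1 + + q)))
               + (+ 1 - + r) + (+ a + + a + + a) ≡ -[1+ 0 ]
  total≡-1 = lemma (+ r) (+ q) (+ a) (+ b)
    where
    lemma : ∀ r q a b → r + q * + 2 + (a - (b + b)) + ((b - (a + a)) - (+ 1 + q) + ((b - (a + a)) - (+ 1 + q)))
              + (+ 1 - r) + (a + a + a) ≡ - + 1
    lemma = solve-∀
transfer-bound -[1+ j ] a b leaf≥0 =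
  -- 2c − (b − 2a) is twice the leaf's final value plus 3b.
  ≤-by-slack _ (ℤP.+-mono-≤ (ℤP.+-mono-≤ leaf≥0 leaf≥0) (+≤+ ℕ.z≤n)) (lemma (+ suc j) (+ a) (+ b))
  where
  lemma : ∀ J a b → + 2 * (- J) ≡ b - (a + a) + ((- J + (a - (b + b))) + (- J + (a - (b + b))) + (b + b + b))
  lemma = solve-∀

transfer-attained : ∀ c → Σ ℕ λ a → Σ ℕ λ b →
  (+ 0 ≤ c + balance (+ a) (+ b)) × balance (+ b) (+ a) ≡ transfer c
transfer-attained (+ k) =
  0 , k ℕ./ 2 , ≤-by-slack (+ (k ℕ.% 2)) (+≤+ ℕ.z≤n) leaf≡parity , ℤP.+-identityʳ _
  where
  leaf≡parity : + k + balance (+ 0) (+ (k ℕ./ 2)) ≡ + 0 + + (k ℕ.% 2)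
  leaf≡parity = trans (cong (_+ balance (+ 0) (+ (k ℕ./ 2))) (halve k)) (lemma (+ (k ℕ.% 2)) (+ (k ℕ./ 2)))
    where
    lemma : ∀ r q → r + q * + 2 + (+ 0 - (q + q)) ≡ + 0 + r
    lemma = solve-∀
transfer-attained -[1+ j ] =
  suc j , 0 , ℤP.≤-reflexive (sym (leaf≡0 (+ suc j))) , gain≡ (+ suc j)
  where
  leaf≡0 : ∀ J → - J + (J - (+ 0 + + 0)) ≡ + 0
  leaf≡0 = solve-∀
  gain≡ : ∀ J → + 0 - (J + J) ≡ + 2 * (- J)
  gain≡ = solve-∀

─-shorter : ∀ {A : Set} {P : A → Set} (m : List A) (p : Any P m) → length (m ─ p) ℕ.< length m
─-shorter m p = ℕP.≤-reflexive (sym (length-removeAt′ m (Any.index p)))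

-- Net effects of edge lists in an arbitrary graph, and the criterion (*).

module NetEffect {n : ℕ} (G : Graph n) where

  record Edge : Set where
    constructor edge
    field
      src tgt : Fin n
      adj : G src tgt
  open Edge public

  δ : Edge → Fin n → ℤ
  δ e z = balance (𝟙 (tgt e) z) (𝟙 (src e) z)

  δ-endpoints : ∀ e {s t} → src e ≡ s → tgt e ≡ t → ∀ z → δ e z ≡ balance (𝟙 t z) (𝟙 s z)
  δ-endpoints e refl refl z = refl

  -- Net effect of performing every move of a list, ignoring legality.
  net : List Edge → Fin n → ℤ
  net [] z = + 0
  net (e ∷ m) z = δ e z + net m z

  net-++ : ∀ m₁ m₂ z → net (m₁ ++ m₂) z ≡ net m₁ z + net m₂ z
  net-++ [] m₂ z = sym (ℤP.+-identityˡ _)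
  net-++ (e ∷ m₁) m₂ z = trans (cong (_+_ (δ e z)) (net-++ m₁ m₂ z)) (sym (ℤP.+-assoc (δ e z) _ _))

  net-─ : ∀ {P : Edge → Set} m (p : Any P m) z → net m z ≡ δ (Any.lookup p) z + net (m ─ p) z
  net-─ (e ∷ m) (Any.here _) z = refl
  net-─ (e ∷ m) (Any.there p) z = trans (cong (_+_ (δ e z)) (net-─ m p z)) (swap (δ e z) (δ (Any.lookup p) z) (net (m ─ p) z))
    where
    swap : ∀ a b c → a + (b + c) ≡ b + (a + c)
    swap = solve-∀

  net-nonpos : ∀ c m → All (λ e → tgt e ≢ c) m → net m c ≤ + 0
  net-nonpos c [] All.[] = ℤP.≤-refl
  net-nonpos c (e ∷ m) (tgt≢c All.∷ rest) = ℤP.+-mono-≤ δ≤0 (net-nonpos c m rest)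
    where
    loss = 𝟙 (src e) c
    δ≤0 : δ e c ≤ + 0
    δ≤0 rewrite 𝟙-other {a = tgt e} (λ c≡t → tgt≢c (sym c≡t)) =
      ≤-by-slack (loss + loss) (ℤP.+-mono-≤ (0≤𝟙 (src e) c) (0≤𝟙 (src e) c)) (lemma loss)
      where
      lemma : ∀ i → + 0 ≡ + 0 - (i + i) + (i + i)
      lemma = solve-∀

  Balances : GenDistribution n → List Edge → Set
  Balances C m = ∀ z → + 0 ≤ C z + net m z

  Balanced : GenDistribution n → Set
  Balanced C = Σ (List Edge) (Balances C)

  fire : GenDistribution n → Edge → GenDistribution n
  fire C e = update (update C (src e) (λ w → w - + 2)) (tgt e) (λ w → w + + 1)

  fire-effect : ∀ C e z → fire C e z ≡ C z + δ e z
  fire-effect C e z = begin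
    fire C e z                                                     ≡⟨ update-shift _ (tgt e) (+ 1) z ⟩
    update C (src e) (λ w → w - + 2) z + 𝟙 (tgt e) z * + 1          ≡⟨ cong (_+ _) (update-shift C (src e) (- + 2) z) ⟩
    C z + 𝟙 (src e) z * (- + 2) + 𝟙 (tgt e) z * + 1                ≡⟨ lemma (C z) (𝟙 (src e) z) (𝟙 (tgt e) z) ⟩
    C z + δ e z                                                    ∎
    where
    open ≡-Reasoning
    lemma : ∀ c s t → c + s * (- + 2) + t * + 1 ≡ c + (t - (s + s))
    lemma = solve-∀

  balances-fire : ∀ {P : Edge → Set} C m (p : Any P m) → Balances C m → Balances (fire C (Any.lookup p)) (m ─ p)
  balances-fire C m p bal z = subst (+ 0 ≤_) (sym C′≡) (bal z)
    where
    e = Any.lookup p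
    open ≡-Reasoning
    C′≡ : fire C e z + net (m ─ p) z ≡ C z + net m z
    C′≡ = begin
      fire C e z + net (m ─ p) z       ≡⟨ cong (_+ net (m ─ p) z) (fire-effect C e z) ⟩
      C z + δ e z + net (m ─ p) z      ≡⟨ ℤP.+-assoc (C z) _ _ ⟩
      C z + (δ e z + net (m ─ p) z)    ≡⟨ cong (_+_ (C z)) (sym (net-─ m p z)) ⟩
      C z + net m z                    ∎

  reachable⇒net : ∀ {C F} → Reachable G C F → Σ (List Edge) λ m → ∀ z → F z ≡ C z + net m z
  reachable⇒net {C} ε = [] , λ z → sym (ℤP.+-identityʳ (C z))
  reachable⇒net (move C x y a _ ◅ rest) with reachable⇒net rest
  ... | m , F≡ = e ∷ m , λ z → trans (F≡ z)
                   (trans (cong (_+ net m z) (fire-effect C e z)) (ℤP.+-assoc (C z) _ _))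
    where e = edge x y a

  Rich : GenDistribution n → Fin n → Set
  Rich C x = + 2 ≤ C x

  Stuck : GenDistribution n → List Edge → Set
  Stuck C = All (λ e → ¬ Rich C (src e))

  -- The no-cycle argument: if C is balanced by m₀ and the edges of m₀ are
  -- stuck, one can delete a closed walk from m₀, which only increases the
  -- net effect.  The walk is traced backwards, always entering the current
  -- (poor) vertex by an edge of the remaining list.
  module ClosedWalk (C : GenDistribution n) (m₀ : List Edge) (bal₀ : Balances C m₀) where

    -- The edges removed from m₀ to obtain m form a walk from c to s; such a
    -- walk changes the net effect by at most 𝟙 s − 2·𝟙 c.
    WalkRemoved : List Edge → Fin n → Fin n → Set
    WalkRemoved m c s = ∀ z → net m₀ z ≤ net m z + balance (𝟙 s z) (𝟙 c z)

    Improvement : List Edge → Set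
    Improvement m = Σ (List Edge) λ m′ → length m′ ℕ.≤ length m × (∀ z → net m₀ z ≤ net m′ z)

    closed : ∀ {m s} → WalkRemoved m s s → ∀ z → net m₀ z ≤ net m z
    closed {m} {s} walk z = ℤP.≤-trans (walk z) (≤-by-slack (𝟙 s z) (0≤𝟙 s z) (lemma (net m z) (𝟙 s z)))
      where
      lemma : ∀ N i → N ≡ N + (i - (i + i)) + i
      lemma = solve-∀

    -- A poor vertex c ≠ s at the front of the walk is entered by a
    -- remaining edge: otherwise it would need two pebbles to end nonnegative.
    entered : ∀ {m c s} → c ≢ s → ¬ Rich C c → WalkRemoved m c s → Any (λ e → tgt e ≡ c) m
    entered {m} {c} {s} c≢s poor walk with any? (λ e → tgt e ≟ c) m
    ... | yes p = p
    ... | no none = contradiction rich poor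
      where
      walk-c : net m₀ c ≤ net m c + balance (+ 0) (+ 1)
      walk-c = subst₂ (λ i j → net m₀ c ≤ net m c + balance i j) (𝟙-other c≢s) (𝟙-self c) (walk c)
      rich : Rich C c
      rich = ≤-by-slack _
        (ℤP.+-mono-≤ (ℤP.+-mono-≤ (bal₀ c) (ℤP.i≤j⇒0≤j-i walk-c))
                     (ℤP.i≤j⇒0≤j-i (net-nonpos c m (¬Any⇒All¬ m none))))
        (lemma (C c) (net m₀ c) (net m c))
        where
        lemma : ∀ K N₀ N → K ≡ + 2 + (K + N₀ + (N + (+ 0 - (+ 1 + + 1)) - N₀) + (+ 0 - N))
        lemma = solve-∀

    extend : ∀ {m c s} (p : Any (λ e → tgt e ≡ c) m) → WalkRemoved m c s → WalkRemoved (m ─ p) (src (Any.lookup p)) s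
    extend {m} {c} {s} p walk z = begin
      net m₀ z                                                        ≤⟨ walk z ⟩
      net m z + balance (𝟙 s z) (𝟙 c z)                               ≡⟨ cong (_+ _) (net-─ m p z) ⟩
      δ e z + net (m ─ p) z + balance (𝟙 s z) (𝟙 c z)                 ≡⟨ cong (λ t → balance (𝟙 t z) (𝟙 c′ z) + net (m ─ p) z + balance (𝟙 s z) (𝟙 c z)) (lookup-result p) ⟩
      balance (𝟙 c z) (𝟙 c′ z) + net (m ─ p) z + balance (𝟙 s z) (𝟙 c z)
        ≤⟨ ≤-by-slack (𝟙 c z) (0≤𝟙 c z) (lemma (𝟙 c z) (𝟙 c′ z) (𝟙 s z) (net (m ─ p) z)) ⟩
      net (m ─ p) z + balance (𝟙 s z) (𝟙 c′ z)                        ∎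
      where
      open ℤP.≤-Reasoning
      e = Any.lookup p
      c′ = src e
      lemma : ∀ c c′ s R → R + (s - (c′ + c′)) ≡ c - (c′ + c′) + R + (s - (c + c)) + c
      lemma = solve-∀

    trace : ∀ {k} m → length m ℕ.< k → Stuck C m → ∀ c s → ¬ Rich C c → WalkRemoved m c s → Improvement m
    trace {suc k} m (s≤s len) stuck c s poor walk with c ≟ s
    ... | yes refl = m , ℕP.≤-refl , closed {m} walk
    ... | no c≢s with trace (m ─ p) shorter (─⁺ p stuck) (src (Any.lookup p)) s
                         (proj₁ (lookupAny stuck p)) (extend p walk)
      where
      p = entered c≢s poor walk
      shorter = ℕP.<-≤-trans (─-shorter m p) len
    ...   | m′ , m′≤ , better = m′ , ℕP.≤-trans m′≤ (ℕP.<⇒≤ (─-shorter m _)) , better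

  -- Executing a balancing list: fire an edge of m that can fire, or, if
  -- none can, delete a closed walk from m.  Either way m gets shorter; the
  -- fuel k bounds its length.
  realise : ∀ {k} C m → length m ℕ.< k → Balances C m → ZeroSolvable G C
  realise C [] _ bal = C , ε , λ z → subst (+ 0 ≤_) (ℤP.+-identityʳ (C z)) (bal z)
  realise {suc k} C m@(e ∷ m′) (s≤s len) bal with any? (λ e → + 2 ≤? C (src e)) m
  ... | yes p with realise (fire C (Any.lookup p)) (m ─ p) shorter (balances-fire C m p bal)
    where
    shorter = ℕP.<-≤-trans (─-shorter m p) len
  ...   | C* , steps , C*≥0 = C* , move C _ _ (adj (Any.lookup p)) (lookup-result p) ◅ steps , C*≥0
  realise {suc k} C (e ∷ m′) (s≤s len) bal | no none with ¬Any⇒All¬ (e ∷ m′) none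
  ... | e-poor All.∷ stuck with ClosedWalk.trace C (e ∷ m′) bal m′ len stuck (src e) (tgt e) e-poor walk₀
    where
    walk₀ : ∀ z → net (e ∷ m′) z ≤ net m′ z + δ e z
    walk₀ z = ℤP.≤-reflexive (ℤP.+-comm (δ e z) (net m′ z))
  ...   | m″ , m″≤ , better = realise C m″ (ℕP.≤-<-trans m″≤ len)
                                (λ z → ℤP.≤-trans (bal z) (ℤP.+-monoʳ-≤ (C z) (better z)))

  solvable⇔balanced : ∀ C → ZeroSolvable G C ⇔ Balanced C
  solvable⇔balanced C = mk⇔ recorded (λ (m , bal) → realise C m ℕP.≤-refl bal)
    where
    recorded : ZeroSolvable G C → Balanced C
    recorded (F , steps , F≥0) with reachable⇒net steps
    ... | m , F≡ = m , λ z → subst (+ 0 ≤_) (F≡ z) (F≥0 z)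

module Pendant {n : ℕ} (G : Graph (suc n)) (simple : IsSimple G) (v u : Fin (suc n))
               (pendant : IsLeafWithNeighbour G v u) where

  G∖v = deleteVertex G v
  module N = NetEffect G
  module N′ = NetEffect G∖v
  open N using (src; tgt; net)

  u≢v : u ≢ v
  u≢v refl = proj₂ simple v (proj₁ pendant)

  v≢punchIn : ∀ i → v ≢ punchIn v i
  v≢punchIn i v≡ = FinP.punchInᵢ≢i v i (sym v≡)

  atU : Fin n → ℤ
  atU i = 𝟙 u (punchIn v i)

  every-vertex : (P : Fin (suc n) → Set) → P v → (∀ i → P (punchIn v i)) → ∀ z → P z
  every-vertex P Pv Prest z with v ≟ z
  ... | yes refl = Pv
  ... | no v≢z = subst P (FinP.punchIn-punchOut v≢z) (Prest _)

  collapse-value : ∀ C i → collapse C v u i ≡ C (punchIn v i) + atU i * transfer (C v)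
  collapse-value C i with punchIn v i ≟ u
  ... | yes _ = cong (_+_ (C (punchIn v i))) (sym (ℤP.*-identityˡ _))
  ... | no _ = trans (sym (ℤP.+-identityʳ _)) (cong (_+_ (C (punchIn v i))) (sym (ℤP.*-zeroˡ (transfer (C v)))))

  -- m acts like a edges u → v, b edges v → u and the list m′ inside G ∖ v.
  record SplitsAs (m : List N.Edge) (m′ : List N′.Edge) (a b : ℕ) : Set where
    constructor splits
    field
      at-leaf : net m v ≡ balance (+ a) (+ b)
      off-leaf : ∀ i → net m (punchIn v i) ≡ N′.net m′ i + atU i * balance (+ b) (+ a)

  Split : List N.Edge → Set
  Split m = Σ (List N′.Edge) λ m′ → Σ ℕ λ a → Σ ℕ λ b → SplitsAs m m′ a b

  []-splits : SplitsAs [] [] 0 0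
  []-splits = splits refl λ i → sym (lemma (atU i))
    where
    lemma : ∀ x → + 0 + x * (+ 0 - (+ 0 + + 0)) ≡ + 0
    lemma = solve-∀

  ++-splits : ∀ {m₁ m₂ m₁′ m₂′ a₁ a₂ b₁ b₂} → SplitsAs m₁ m₁′ a₁ b₁ → SplitsAs m₂ m₂′ a₂ b₂ →
              SplitsAs (m₁ ++ m₂) (m₁′ ++ m₂′) (a₁ ℕ.+ a₂) (b₁ ℕ.+ b₂)
  ++-splits {m₁} {m₂} {m₁′} {m₂′} {a₁} {a₂} {b₁} {b₂} (splits v₁ rest₁) (splits v₂ rest₂) = splits at-v at-rest
    where
    at-v : net (m₁ ++ m₂) v ≡ balance (+ (a₁ ℕ.+ a₂)) (+ (b₁ ℕ.+ b₂))
    at-v = trans (N.net-++ m₁ m₂ v)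
             (trans (cong₂ _+_ v₁ v₂) (sym (balance-+ (+ a₁) (+ b₁) (+ a₂) (+ b₂))))
    at-rest : ∀ i → net (m₁ ++ m₂) (punchIn v i) ≡ N′.net (m₁′ ++ m₂′) i + atU i * balance (+ (b₁ ℕ.+ b₂)) (+ (a₁ ℕ.+ a₂))
    at-rest i = begin
      net (m₁ ++ m₂) (punchIn v i)                                            ≡⟨ N.net-++ m₁ m₂ _ ⟩
      net m₁ (punchIn v i) + net m₂ (punchIn v i)                              ≡⟨ cong₂ _+_ (rest₁ i) (rest₂ i) ⟩
      N′.net m₁′ i + atU i * B₁ + (N′.net m₂′ i + atU i * B₂)                  ≡⟨ lemma (N′.net m₁′ i) (N′.net m₂′ i) (atU i) B₁ B₂ ⟩
      N′.net m₁′ i + N′.net m₂′ i + atU i * (B₁ + B₂)                          ≡⟨ cong₂ (λ x y → x + atU i * y) (sym (N′.net-++ m₁′ m₂′ i))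
                                                                                   (sym (balance-+ (+ b₁) (+ a₁) (+ b₂) (+ a₂))) ⟩
      N′.net (m₁′ ++ m₂′) i + atU i * balance (+ (b₁ ℕ.+ b₂)) (+ (a₁ ℕ.+ a₂))  ∎
      where
      open ≡-Reasoning
      B₁ = balance (+ b₁) (+ a₁)
      B₂ = balance (+ b₂) (+ a₂)
      lemma : ∀ N₁ N₂ o x y → N₁ + o * x + (N₂ + o * y) ≡ N₁ + N₂ + o * (x + y)
      lemma = solve-∀

  single-splits : ∀ {e s t m′ a b} → src e ≡ s → tgt e ≡ t →
    balance (𝟙 t v) (𝟙 s v) ≡ balance (+ a) (+ b) →
    (∀ i → balance (𝟙 t (punchIn v i)) (𝟙 s (punchIn v i)) ≡ N′.net m′ i + atU i * balance (+ b) (+ a)) →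
    SplitsAs [ e ] m′ a b
  single-splits {e} src≡ tgt≡ at-v at-rest =
    splits (trans (ℤP.+-identityʳ _) (trans (N.δ-endpoints e src≡ tgt≡ v) at-v))
      λ i → trans (ℤP.+-identityʳ _) (trans (N.δ-endpoints e src≡ tgt≡ (punchIn v i)) (at-rest i))

  toLeaf-splits : ∀ e → src e ≡ u → tgt e ≡ v → SplitsAs [ e ] [] 1 0
  toLeaf-splits e src≡ tgt≡ = single-splits src≡ tgt≡ at-v at-rest
    where
    at-v : balance (𝟙 v v) (𝟙 u v) ≡ balance (+ 1) (+ 0)
    at-v = cong₂ balance (𝟙-self v) (𝟙-other (λ v≡u → u≢v (sym v≡u)))
    at-rest : ∀ i → balance (𝟙 v (punchIn v i)) (atU i) ≡ + 0 + atU i * balance (+ 0) (+ 1)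
    at-rest i rewrite 𝟙-other (λ pi≡v → v≢punchIn i (sym pi≡v)) = lemma (atU i)
      where
      lemma : ∀ x → + 0 - (x + x) ≡ + 0 + x * (+ 0 - (+ 1 + + 1))
      lemma = solve-∀

  fromLeaf-splits : ∀ e → src e ≡ v → tgt e ≡ u → SplitsAs [ e ] [] 0 1
  fromLeaf-splits e src≡ tgt≡ = single-splits src≡ tgt≡ at-v at-rest
    where
    at-v : balance (𝟙 u v) (𝟙 v v) ≡ balance (+ 0) (+ 1)
    at-v = cong₂ balance (𝟙-other (λ v≡u → u≢v (sym v≡u))) (𝟙-self v)
    at-rest : ∀ i → balance (atU i) (𝟙 v (punchIn v i)) ≡ + 0 + atU i * balance (+ 1) (+ 0)
    at-rest i rewrite 𝟙-other (λ pi≡v → v≢punchIn i (sym pi≡v)) = lemma (atU i)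
      where
      lemma : ∀ x → x - (+ 0 + + 0) ≡ + 0 + x * (+ 1 - (+ 0 + + 0))
      lemma = solve-∀

  inner-splits : ∀ e e′ → src e ≡ punchIn v (N′.src e′) → tgt e ≡ punchIn v (N′.tgt e′) → SplitsAs [ e ] [ e′ ] 0 0
  inner-splits e e′ src≡ tgt≡ = single-splits src≡ tgt≡ at-v at-rest
    where
    at-v : balance (𝟙 (punchIn v (N′.tgt e′)) v) (𝟙 (punchIn v (N′.src e′)) v) ≡ balance (+ 0) (+ 0)
    at-v = cong₂ balance (𝟙-other (v≢punchIn _)) (𝟙-other (v≢punchIn _))
    at-rest : ∀ i → balance (𝟙 (punchIn v (N′.tgt e′)) (punchIn v i)) (𝟙 (punchIn v (N′.src e′)) (punchIn v i))
                    ≡ N′.net [ e′ ] i + atU i * balance (+ 0) (+ 0)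
    at-rest i = begin
      balance (𝟙 (punchIn v (N′.tgt e′)) (punchIn v i)) (𝟙 (punchIn v (N′.src e′)) (punchIn v i))
        ≡⟨ cong₂ balance (𝟙-punchIn v _ i) (𝟙-punchIn v _ i) ⟩
      N′.δ e′ i                                  ≡⟨ lemma (N′.δ e′ i) (atU i) ⟩
      N′.δ e′ i + + 0 + atU i * balance (+ 0) (+ 0) ∎
      where
      open ≡-Reasoning
      lemma : ∀ d x → d ≡ d + + 0 + x * (+ 0 - (+ 0 + + 0))
      lemma = solve-∀

  edge-split : ∀ e → Split [ e ]
  edge-split e@(N.edge x y x~y) with x ≟ v | y ≟ v
  ... | yes refl | yes refl = ⊥-elim (proj₂ simple v x~y)
  ... | yes refl | no _ = [] , 0 , 1 , fromLeaf-splits e refl (proj₂ pendant y x~y)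
  ... | no _ | yes refl = [] , 1 , 0 , toLeaf-splits e (proj₂ pendant x (proj₁ simple x v x~y)) refl
  ... | no x≢v | no y≢v = [ e′ ] , 0 , 0 , inner-splits e e′ (sym x≡) (sym y≡)
    where
    x′ = punchOut (λ v≡x → x≢v (sym v≡x))
    y′ = punchOut (λ v≡y → y≢v (sym v≡y))
    x≡ : punchIn v x′ ≡ x
    x≡ = FinP.punchIn-punchOut _
    y≡ : punchIn v y′ ≡ y
    y≡ = FinP.punchIn-punchOut _
    e′ : N′.Edge
    e′ = N′.edge x′ y′ (subst₂ G (sym x≡) (sym y≡) x~y)

  split : ∀ m → Split m
  split [] = [] , 0 , 0 , []-splits
  split (e ∷ m) with edge-split e | split m
  ... | m₁′ , a₁ , b₁ , s₁ | m₂′ , a₂ , b₂ , s₂ = m₁′ ++ m₂′ , a₁ ℕ.+ a₂ , b₁ ℕ.+ b₂ , ++-splits s₁ s₂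

  unsplit : ∀ m′ a b → Σ (List N.Edge) λ m → SplitsAs m m′ a b
  unsplit m′ (suc a) b with unsplit m′ a b
  ... | m , s = u→v ∷ m , ++-splits (toLeaf-splits u→v refl refl) s
    where u→v = N.edge u v (proj₁ simple v u (proj₁ pendant))
  unsplit m′ zero (suc b) with unsplit m′ zero b
  ... | m , s = v→u ∷ m , ++-splits (fromLeaf-splits v→u refl refl) s
    where v→u = N.edge v u (proj₁ pendant)
  unsplit [] zero zero = [] , []-splits
  unsplit (e′ ∷ m′) zero zero with unsplit m′ zero zero
  ... | m , s = lifted ∷ m , ++-splits (inner-splits lifted e′ refl refl) s
    where lifted = N.edge (punchIn v (N′.src e′)) (punchIn v (N′.tgt e′)) (N′.adj e′)

  Fits : GenDistribution (suc n) → List N′.Edge → ℕ → ℕ → Set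
  Fits C m′ a b = + 0 ≤ C v + balance (+ a) (+ b)
                × (∀ i → + 0 ≤ C (punchIn v i) + (N′.net m′ i + atU i * balance (+ b) (+ a)))

  Fittable : GenDistribution (suc n) → Set
  Fittable C = Σ (List N′.Edge) λ m′ → Σ ℕ λ a → Σ ℕ λ b → Fits C m′ a b

  balances⇔fits : ∀ {C m m′ a b} → SplitsAs m m′ a b → N.Balances C m ⇔ Fits C m′ a b
  balances⇔fits {C} {m} (splits at-v at-rest) = mk⇔
    (λ bal → subst (λ t → + 0 ≤ C v + t) at-v (bal v)
           , λ i → subst (λ t → + 0 ≤ C (punchIn v i) + t) (at-rest i) (bal (punchIn v i)))
    (λ (fits-v , fits-rest) → every-vertex (λ z → + 0 ≤ C z + net m z)
      (subst (λ t → + 0 ≤ C v + t) (sym at-v) fits-v)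
      (λ i → subst (λ t → + 0 ≤ C (punchIn v i) + t) (sym (at-rest i)) (fits-rest i)))

  balanced⇔fittable : ∀ C → N.Balanced C ⇔ Fittable C
  balanced⇔fittable C = mk⇔
    (λ (m , bal) → let (m′ , a , b , s) = split m in m′ , a , b , Equivalence.to (balances⇔fits {C} s) bal)
    (λ (m′ , a , b , fits) → let (m , s) = unsplit m′ a b in m , Equivalence.from (balances⇔fits {C} s) fits)

  -- Fitting splits of C correspond to balancing lists of the collapsed
  -- distribution, since transfer (C v) is the best possible b − 2a.
  fittable⇔collapse-balanced : ∀ C → Fittable C ⇔ N′.Balanced (collapse C v u)
  fittable⇔collapse-balanced C = mk⇔ to from
    where
    reorder : ∀ m′ i x → C (punchIn v i) + atU i * x + N′.net m′ i ≡ C (punchIn v i) + (N′.net m′ i + atU i * x)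
    reorder m′ i x = lemma (C (punchIn v i)) (atU i) x (N′.net m′ i)
      where
      lemma : ∀ c o x N → c + o * x + N ≡ c + (N + o * x)
      lemma = solve-∀
    collapsed : ∀ m′ i → collapse C v u i + N′.net m′ i ≡ C (punchIn v i) + (N′.net m′ i + atU i * transfer (C v))
    collapsed m′ i = trans (cong (_+ N′.net m′ i) (collapse-value C i)) (reorder m′ i (transfer (C v)))
    to : Fittable C → N′.Balanced (collapse C v u)
    to (m′ , a , b , fits-v , fits-rest) = m′ , λ i →
      ℤP.≤-trans (fits-rest i)
        (subst (C (punchIn v i) + (N′.net m′ i + atU i * balance (+ b) (+ a)) ≤_) (sym (collapsed m′ i))
          (ℤP.+-monoʳ-≤ (C (punchIn v i)) (ℤP.+-monoʳ-≤ (N′.net m′ i)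
            (𝟙-*-mono u (punchIn v i) (transfer-bound (C v) a b fits-v)))))
    from : N′.Balanced (collapse C v u) → Fittable C
    from (m′ , bal) with transfer-attained (C v)
    ... | a , b , fits-v , gain≡ = m′ , a , b , fits-v , λ i →
      subst (+ 0 ≤_) (trans (collapsed m′ i)
        (cong (λ t → C (punchIn v i) + (N′.net m′ i + atU i * t)) (sym gain≡))) (bal i)

  leaf-reduction : ∀ C → ZeroSolvable G C ⇔ ZeroSolvable G∖v (collapse C v u)
  leaf-reduction C = begin
    ZeroSolvable G C                      ∼⟨ N.solvable⇔balanced C ⟩
    N.Balanced C                          ∼⟨ balanced⇔fittable C ⟩
    Fittable C                            ∼⟨ fittable⇔collapse-balanced C ⟩
    N′.Balanced (collapse C v u)          ∼⟨ ⇔-sym (N′.solvable⇔balanced (collapse C v u)) ⟩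
    ZeroSolvable G∖v (collapse C v u)     ∎
    where open EquationalReasoning

-- The theorem.
lemma3 : (n : ℕ) → 1 ℕ.≤ n → (T : Graph (suc n)) → IsTree T →
    (D : Distribution (suc n)) → (ω : Fin (suc n) → ℕ) → (v u : Fin (suc n)) →
    IsLeafWithNeighbour T v u →
    ZeroSolvable T (D minus ω) ⇔ ZeroSolvable (deleteVertex T v) (collapse (D minus ω) v u)
lemma3 n _ T (simple , _) D ω v u pendant = Pendant.leaf-reduction T simple v u pendant (D minus ω)
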